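{- Let $G$ be a finite graph with $\alpha(G)=2$ and let $\mathfrak A$ be a partition of $V(G)$ into exactly $\chi(G)$ independent sets. Let $\{u\},\{v\}\in\mathfrak A$ be singleton classes and let $A\in\mathfrak A$ be a class with $|A|=2$. If $|E(u,A)|=|E(v,A)|=1$, then $u$ and $v$ have a common neighbour in $A$.
   Context: $E(u,A)$ denotes the set of edges of $G$ joining $u$ to a vertex of $A$. Since $\alpha(G)=2$, every class of $\mathfrak A$ has size $1$ or $2$. -}

module Defs where

open import Data.Nat using (ℕ; _≤_; _<_)
open import Data.Bool using (Bool; true; false)
open import Data.Fin using (Fin)
open import Data.Fin.Subset using (Subset; _∈_; ∣_∣; _∩_; ⁅_⁆)
open import Data.Vec using (tabulate)
open import Data.Product using (Σ; _×_; ∃)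
open import Relation.Binary.PropositionalEquality using (_≡_; _≢_)
open import Relation.Nullary using (¬_)
open import Relation.Nullary.Decidable using (⌊_⌋)
open import Function.Definitions using (Surjective)
import Data.Fin as F

record Graph (n : ℕ) : Set where
  field
    Adj    : Fin n → Fin n → Bool
    sym    : ∀ x y → Adj x y ≡ Adj y x
    irrefl : ∀ x → Adj x x ≡ false
open Graph public

N : ∀ {n} → Graph n → Fin n → Subset n
N G u = tabulate (Adj G u)

Independent : ∀ {n} → Graph n → Subset n → Set
Independent G S = ∀ x y → x ∈ S → y ∈ S → Adj G x y ≡ false

IndependenceNumber : ∀ {n} → Graph n → ℕ → Set
IndependenceNumber {n} G a =
  Σ (Subset n) (λ S → Independent G S × ∣ S ∣ ≡ a)
  × (∀ (S : Subset n) → Independent G S → ∣ S ∣ ≤ a)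

Proper : ∀ {n k} → Graph n → (Fin n → Fin k) → Set
Proper G c = ∀ x y → Adj G x y ≡ true → c x ≢ c y

Colourable : ∀ {n} → Graph n → ℕ → Set
Colourable {n} G k = Σ (Fin n → Fin k) (Proper G)

ChromaticNumber : ∀ {n} → Graph n → ℕ → Set
ChromaticNumber G k = Colourable G k × (∀ m → m < k → ¬ Colourable G m)

-- A partition of V(G) into exactly k independent (nonempty) classes,
-- encoded by the class-assignment map c (surjective = every class nonempty).
IndependentPartition : ∀ {n} → Graph n → (k : ℕ) → (Fin n → Fin k) → Set
IndependentPartition G k c = Proper G c × Surjective _≡_ _≡_ c

Class : ∀ {n k} → (Fin n → Fin k) → Fin k → Subset n
Class c i = tabulate (λ w → ⌊ c w F.≟ i ⌋)

EdgeCount : ∀ {n} → Graph n → Fin n → Subset n → ℕ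
EdgeCount G u A = ∣ N G u ∩ A ∣

{-# OPTIONS --safe #-}
module Submission where

-- If v is not adjacent to the unique neighbour a of u in A, move a into v's
-- class {v} and then u into A ∖ {a}.  Both moves keep the colouring proper and
-- together they empty the class {u}, so χ(G) − 1 colours would suffice.

open import Defs hiding (sym)
open import Data.Nat using (ℕ; suc; _<_)
open import Data.Nat.Properties using (≤-refl; n≮0; n<1⇒n≡0)
open import Data.Fin using (Fin; punchOut; _≟_)
open import Data.Fin.Properties using (punchOut-injective)
open import Data.Fin.Subset using (Subset; _∈_; ∣_∣; ⁅_⁆; _-_; Nonempty)
open import Data.Fin.Subset.Properties
  using (x∈p∩q⁺; x∈p∩q⁻; x∈⁅y⁆⇒x≡y; ∣⁅x⁆∣≡1; x∈p⇒∣p-x∣<∣p∣; x∈p∧x≢y⇒x∈p-y;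
         nonempty?; Empty-unique; ∣⊥∣≡0)
open import Data.Bool using (Bool; true; false)
open import Data.Bool.Properties using (T-≡)
open import Data.Product using (Σ; _×_; _,_)
open import Data.Vec using (tabulate)
open import Data.Vec.Functional using (updateAt)
open import Data.Vec.Functional.Properties using (updateAt-updates; updateAt-minimal)
open import Data.Vec.Properties using (lookup∘tabulate; []=⇒lookup; lookup⇒[]=)
open import Data.Empty using (⊥-elim)
open import Function using (_∘_; const; case_of_)
open import Function.Bundles using (Equivalence)
open import Relation.Nullary using (¬_; yes; no; contradiction)
open import Relation.Nullary.Decidable using (toWitness; fromWitness)
open import Relation.Binary.PropositionalEquality
  using (_≡_; _≢_; refl; sym; trans; cong; subst; module ≡-Reasoning)

private
  variable
    n k : ℕ

∈-tabulate⁺ : (f : Fin n → Bool) {w : Fin n} → f w ≡ true → w ∈ tabulate f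
∈-tabulate⁺ f {w} fw≡true = lookup⇒[]= w _ (trans (lookup∘tabulate f w) fw≡true)

∈-tabulate⁻ : (f : Fin n → Bool) {w : Fin n} → w ∈ tabulate f → f w ≡ true
∈-tabulate⁻ f {w} w∈f = trans (sym (lookup∘tabulate f w)) ([]=⇒lookup w∈f)

∈-Class⁺ : (c : Fin n → Fin k) {i : Fin k} {w : Fin n} → c w ≡ i → w ∈ Class c i
∈-Class⁺ c cw≡i = ∈-tabulate⁺ _ (Equivalence.to T-≡ (fromWitness cw≡i))

∈-Class⁻ : (c : Fin n → Fin k) {i : Fin k} {w : Fin n} → w ∈ Class c i → c w ≡ i
∈-Class⁻ c w∈i = toWitness (Equivalence.from T-≡ (∈-tabulate⁻ _ w∈i))

Class≡⁅⁆⇒sole-member : (c : Fin n → Fin k) {u w : Fin n}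
  → Class c (c u) ≡ ⁅ u ⁆ → c w ≡ c u → w ≡ u
Class≡⁅⁆⇒sole-member c {u} class≡⁅u⁆ cw≡cu =
  x∈⁅y⁆⇒x≡y u (subst (_ ∈_) class≡⁅u⁆ (∈-Class⁺ c cw≡cu))

x∈p⇒∣p∣≢0 : {p : Subset n} {x : Fin n} → x ∈ p → ∣ p ∣ ≢ 0
x∈p⇒∣p∣≢0 {p = p} {x} x∈p ∣p∣≡0 = n≮0 (subst (∣ p - x ∣ <_) ∣p∣≡0 (x∈p⇒∣p-x∣<∣p∣ x∈p))

∣p∣≡1⇒nonempty : {p : Subset n} → ∣ p ∣ ≡ 1 → Nonempty p
∣p∣≡1⇒nonempty {n} {p} ∣p∣≡1 with nonempty? p
... | yes p≢∅ = p≢∅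
... | no p≡∅ with () ←
  trans (sym (∣⊥∣≡0 n)) (trans (cong ∣_∣ (sym (Empty-unique p≡∅))) ∣p∣≡1)

∣p∣≡1⇒unique : {p : Subset n} {x y : Fin n} → ∣ p ∣ ≡ 1 → x ∈ p → y ∈ p → y ≡ x
∣p∣≡1⇒unique {p = p} {x} {y} ∣p∣≡1 x∈p y∈p with y ≟ x
... | yes y≡x = y≡x
... | no y≢x = contradiction
  (n<1⇒n≡0 (subst (∣ p - x ∣ <_) ∣p∣≡1 (x∈p⇒∣p-x∣<∣p∣ x∈p)))
  (x∈p⇒∣p∣≢0 (x∈p∧x≢y⇒x∈p-y y∈p y≢x))

module _ (G : Graph n) where

  adj⇒≢ : {x y : Fin n} → Adj G x y ≡ true → x ≢ y
  adj⇒≢ {x} xx refl with () ← trans (sym xx) (irrefl G x)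

  adj-sym : {x y : Fin n} → Adj G x y ≡ true → Adj G y x ≡ true
  adj-sym {x} {y} xy = trans (Graph.sym G y x) xy

  recolour-proper : {c : Fin n → Fin k} {x : Fin n} {j : Fin k} → Proper G c
    → (∀ {y} → Adj G x y ≡ true → c y ≢ j) → Proper G (updateAt c x (const j))
  recolour-proper {k} {c} {x} {j} c-proper j-free = d-proper
    where
    open ≡-Reasoning
    d : Fin n → Fin k
    d = updateAt c x (const j)

    d-elsewhere : ∀ {w} → w ≢ x → d w ≡ c w
    d-elsewhere {w} w≢x = updateAt-minimal w x c w≢x

    from-x : ∀ {z} → Adj G x z ≡ true → d x ≢ d z
    from-x {z} xz dx≡dz with z ≟ x
    ... | yes refl = adj⇒≢ xz refl
    ... | no z≢x = j-free xz (begin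
      c z ≡⟨ d-elsewhere z≢x ⟨
      d z ≡⟨ dx≡dz ⟨
      d x ≡⟨ updateAt-updates x c ⟩
      j   ∎)

    d-proper : Proper G d
    d-proper y z yz with y ≟ x | z ≟ x
    ... | yes refl | _        = from-x yz
    ... | no _     | yes refl = from-x (adj-sym yz) ∘ sym
    ... | no y≢x   | no z≢x   = λ dy≡dz → c-proper y z yz (begin
      c y ≡⟨ d-elsewhere y≢x ⟨
      d y ≡⟨ dy≡dz ⟩
      d z ≡⟨ d-elsewhere z≢x ⟩
      c z ∎)

  proper-missing-colour⇒colourable : {c : Fin n → Fin (suc k)} {i : Fin (suc k)}
    → Proper G c → (∀ w → c w ≢ i) → Colourable G k
  proper-missing-colour⇒colourable {i = i} c-proper misses-i =
    (λ w → punchOut (misses-i w ∘ sym)) ,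
    (λ x y xy → c-proper x y xy ∘ punchOut-injective {i = i} _ _)

  chromatic⇒no-colouring-misses-a-colour : ChromaticNumber G k → {i : Fin k}
    → ¬ Σ (Fin n → Fin k) (λ c → Proper G c × (∀ w → c w ≢ i))
  chromatic⇒no-colouring-misses-a-colour {k = suc k} (_ , fewer-colours-fail)
    (_ , c-proper , misses-i) =
    fewer-colours-fail k ≤-refl (proper-missing-colour⇒colourable c-proper misses-i)

  singleton-class-eliminable : {c : Fin n → Fin k} {u v a : Fin n} → Proper G c
    → (∀ {w} → c w ≡ c u → w ≡ u) → (∀ {w} → c w ≡ c v → w ≡ v) → c v ≢ c a
    → Adj G u a ≡ true → (∀ {y} → Adj G u y ≡ true → c y ≡ c a → y ≡ a)
    → Adj G v a ≡ false
    → Σ (Fin n → Fin k) λ d → Proper G d × (∀ w → d w ≢ c u)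
  singleton-class-eliminable {k} {c} {u} {v} {a} c-proper u-alone v-alone cv≢ca ua a-unique va =
    c₂ , c₂-proper , c₂-misses-cu
    where
    c₁ c₂ : Fin n → Fin k
    c₁ = updateAt c a (const (c v))
    c₂ = updateAt c₁ u (const (c a))

    v≁a : Adj G v a ≢ true
    v≁a va≡true with () ← trans (sym va≡true) va

    c₁-proper : Proper G c₁
    c₁-proper = recolour-proper c-proper λ {y} ay cy≡cv →
      v≁a (adj-sym (subst (λ y → Adj G a y ≡ true) (v-alone cy≡cv) ay))

    c₂-proper : Proper G c₂
    c₂-proper = recolour-proper c₁-proper λ {y} uy c₁y≡ca → case y ≟ a of λ where
      (yes refl) → cv≢ca (trans (sym (updateAt-updates a c)) c₁y≡ca)
      (no y≢a)   → y≢a (a-unique uy (trans (sym (updateAt-minimal y a c y≢a)) c₁y≡ca))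

    c₂-misses-cu : ∀ w → c₂ w ≢ c u
    c₂-misses-cu w c₂w≡cu with w ≟ u | w ≟ a
    ... | yes refl | _ =
      adj⇒≢ ua (sym (u-alone (trans (sym (updateAt-updates u c₁)) c₂w≡cu)))
    ... | no w≢u | yes refl =
      v≁a (subst (λ x → Adj G x a ≡ true) (sym (u-alone (begin
        c v  ≡⟨ updateAt-updates a c ⟨
        c₁ a ≡⟨ updateAt-minimal a u c₁ w≢u ⟨
        c₂ a ≡⟨ c₂w≡cu ⟩
        c u  ∎))) ua)
      where open ≡-Reasoning
    ... | no w≢u | no w≢a = w≢u (u-alone (begin
        c w  ≡⟨ updateAt-minimal w a c w≢a ⟨
        c₁ w ≡⟨ updateAt-minimal w u c₁ w≢u ⟨
        c₂ w ≡⟨ c₂w≡cu ⟩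
        c u  ∎))
      where open ≡-Reasoning

lemma3p2 : ∀ {n : ℕ} (G : Graph n) (k : ℕ) (c : Fin n → Fin k)
    → IndependenceNumber G 2
    → ChromaticNumber G k
    → IndependentPartition G k c
    → (u v : Fin n) (A : Fin k)
    → Class c (c u) ≡ ⁅ u ⁆
    → Class c (c v) ≡ ⁅ v ⁆
    → ∣ Class c A ∣ ≡ 2
    → EdgeCount G u (Class c A) ≡ 1
    → EdgeCount G v (Class c A) ≡ 1
    → Σ (Fin n) (λ w → w ∈ Class c A × Adj G u w ≡ true × Adj G v w ≡ true)
lemma3p2 G k c _ χ≡k (c-proper , _) u v A u-single v-single ∣A∣≡2 ∣E[u,A]∣≡1 _
  with a , a∈N[u]∩A ← ∣p∣≡1⇒nonempty ∣E[u,A]∣≡1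
  with a∈N[u] , a∈A ← x∈p∩q⁻ _ _ a∈N[u]∩A
  with Adj G v a in va
... | true  = a , a∈A , ∈-tabulate⁻ _ a∈N[u] , va
... | false = ⊥-elim (chromatic⇒no-colouring-misses-a-colour G χ≡k
  (singleton-class-eliminable G c-proper
    (Class≡⁅⁆⇒sole-member c u-single) (Class≡⁅⁆⇒sole-member c v-single)
    cv≢ca (∈-tabulate⁻ _ a∈N[u]) a-unique va))
  where
  open ≡-Reasoning
  ca≡A : c a ≡ A
  ca≡A = ∈-Class⁻ c a∈A

  a-unique : ∀ {y} → Adj G u y ≡ true → c y ≡ c a → y ≡ a
  a-unique uy cy≡ca = ∣p∣≡1⇒unique ∣E[u,A]∣≡1 a∈N[u]∩A
    (x∈p∩q⁺ (∈-tabulate⁺ _ uy , ∈-Class⁺ c (trans cy≡ca ca≡A)))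

  cv≢ca : c v ≢ c a
  cv≢ca cv≡ca with () ← begin
    2                  ≡⟨ ∣A∣≡2 ⟨
    ∣ Class c A ∣      ≡⟨ cong (∣_∣ ∘ Class c) (trans cv≡ca ca≡A) ⟨
    ∣ Class c (c v) ∣  ≡⟨ cong ∣_∣ v-single ⟩
    ∣ ⁅ v ⁆ ∣          ≡⟨ ∣⁅x⁆∣≡1 v ⟩
    1                  ∎
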